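{- Let $w\in S_\infty$, $k\geq1$, and let $\eta=\eta_1+2\eta_2$ be a multi-set. If $A_k^\eta(w)\neq\emptyset$, then $A_k^\eta(w)$ contains a unique maximal element (with respect to $\leq$), and this element is $\geq$ every element of $A_k^\eta(w)$.
   Context: For $w$ a permutation of the positive integers fixing all but finitely many ($w\in S_\infty$) and $k\geq1$, $w^k=(w^k_1<\dots<w^k_k)$ is the increasing ordering of $w(1),\dots,w(k)$. For strictly increasing sequences $\alpha,\gamma$ of the same length write $\alpha\leq\gamma$ if $\alpha_j\leq\gamma_j$ for all $j$. $A_k(w)$ is the set of strictly increasing sequences $\beta$ of $k$ positive integers with $\beta\leq w^k$; increasing sequences are identified with finite sets. A multi-set $\eta$ of positive integers with multiplicities at most $2$ is written $\eta=\eta_1+2\eta_2$ with $\eta_1,\eta_2$ disjoint finite sets (the elements of multiplicity $1$ and $2$ respectively). $A_k^\eta(w):=\{\beta\in A_k(w):\eta_2\subseteq\beta\subseteq\eta_1\cup\eta_2\}$. -}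

module Defs where

open import Data.Nat using (ℕ; zero; suc; _≤_; _<_)
open import Data.Nat.Properties using (≤-decTotalOrder)
open import Data.List using (List; applyUpTo; length)
open import Data.List.Membership.Propositional using (_∈_; _∉_)
open import Data.List.Relation.Unary.All using (All)
open import Data.List.Relation.Unary.Linked using (Linked)
open import Data.List.Relation.Binary.Pointwise using (Pointwise)
open import Data.List.Sort ≤-decTotalOrder using (sort)
open import Data.Product using (Σ; ∃; _×_)
open import Data.Sum using (_⊎_)
open import Function.Bundles using (_↔_; Inverse)
open import Relation.Binary.PropositionalEquality using (_≡_)

-- Elements of S_∞: bijections of ℕ that fix 0 (so they restrict to
-- permutations of the positive integers) and fix all but finitely many n.
record S∞ : Set where
  field
    perm      : ℕ ↔ ℕ
    fixes-0   : Inverse.to perm 0 ≡ 0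
    fin-supp  : ∃ λ N → ∀ n → N ≤ n → Inverse.to perm n ≡ n

app : S∞ → ℕ → ℕ
app w = Inverse.to (S∞.perm w)

_^[_] : S∞ → ℕ → List ℕ
w ^[ k ] = sort (applyUpTo (λ i → app w (suc i)) k)

-- strictly increasing sequences of positive integers (identified with finite sets)
IncSeq : List ℕ → Set
IncSeq β = Linked _<_ β × All (λ x → 1 ≤ x) β

_⊴_ : List ℕ → List ℕ → Set
α ⊴ γ = Pointwise _≤_ α γ

A : ℕ → S∞ → List ℕ → Set
A k w β = IncSeq β × length β ≡ k × β ⊴ (w ^[ k ])

-- a multi-set η = η₁ + 2η₂ with multiplicities ≤ 2, given by two
-- disjoint finite sets of positive integers (represented as lists)
record MultiSet : Set where
  field
    η₁ η₂    : List ℕ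
    pos₁     : All (λ x → 1 ≤ x) η₁
    pos₂     : All (λ x → 1 ≤ x) η₂
    disjoint : ∀ x → x ∈ η₁ → x ∉ η₂

Aη : ℕ → MultiSet → S∞ → List ℕ → Set
Aη k η w β =
  A k w β
  × (∀ x → x ∈ MultiSet.η₂ η → x ∈ β)
  × (∀ x → x ∈ β → x ∈ MultiSet.η₁ η ⊎ x ∈ MultiSet.η₂ η)

{-# OPTIONS --safe #-}
-- The componentwise maximum of two elements of A_k^η(w) lies again in A_k^η(w):
-- it is strictly increasing and bounded by w^k, each of its entries is an entry of
-- one of the two sequences, and an x ∈ η₂ sitting at position i of β and j ≥ i of γ
-- satisfies γᵢ ≤ x = βᵢ, so x survives as the i-th entry of the maximum.  Every
-- element of A_k^η(w) is bounded by w^k, so the set is finite, and the maximum of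
-- all its elements is its greatest element, hence its unique maximal one.
module Submission where

open import Defs
open import Data.Nat using (ℕ; suc; _≤_; _<_; _⊔_; s≤s; _≟_; _≤?_)
open import Data.Nat.Properties
  using (≤-trans; ≤-antisym; <-trans; <⇒≤; _<?_; suc-injective;
         ⊔-comm; ⊔-idem; ⊔-sel; ⊔-lub; m≤m⊔n; ⊔-mono-<; m≤n⇒m⊔n≡n; m≥n⇒m⊔n≡m)
open import Data.List using (List; []; _∷_; length; zipWith; foldr; filter;
  upTo; cartesianProductWith)
open import Data.List.Properties using (zipWith-comm)
open import Data.List.Membership.Propositional using (_∈_)
open import Data.List.Membership.Propositional.Properties
  using (∈-cartesianProductWith⁺; ∈-upTo⁺; ∈-filter⁺)
open import Data.List.Membership.DecPropositional _≟_ using (_∈?_)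
open import Data.List.Relation.Binary.Subset.DecPropositional _≟_ using (_⊆?_)
open import Data.List.Relation.Unary.Any using (here; there)
open import Data.List.Relation.Unary.All as All using (All; all?)
open import Data.List.Relation.Unary.All.Properties using (all-filter)
open import Data.List.Relation.Unary.AllPairs as AllPairs using ()
open import Data.List.Relation.Unary.Linked as Linked using (Linked; []; [-]; _∷_; linked?)
open import Data.List.Relation.Unary.Linked.Properties using (Linked⇒AllPairs)
open import Data.List.Relation.Binary.Pointwise using ([]; _∷_; Pointwise-≡⇒≡)
open import Data.List.Relation.Binary.Pointwise.Properties as Pointwise
  using (Pointwise-length)
open import Data.Product using (Σ; ∃; _×_; _,_; proj₁)
open import Data.Sum using (_⊎_; inj₁; inj₂; [_,_])
open import Relation.Nullary.Decidable using (map′; _×-dec_; _⊎-dec_)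
open import Level using (0ℓ)
open import Relation.Unary using (Pred; Decidable)
open import Relation.Binary.PropositionalEquality using (_≡_; refl; sym; trans; subst)

module Extremal {A : Set} (_≤ₐ_ : A → A → Set) (antisym : ∀ {x y} → x ≤ₐ y → y ≤ₐ x → x ≡ y) where

  IsGreatest : Pred A 0ℓ → A → Set
  IsGreatest P μ = P μ × (∀ β → P β → β ≤ₐ μ)

  IsMaximal : Pred A 0ℓ → A → Set
  IsMaximal P μ = ∀ β → P β → μ ≤ₐ β → β ≡ μ

  greatest⇒maximal : ∀ {P μ} → IsGreatest P μ → IsMaximal P μ
  greatest⇒maximal (_ , greatest) β Pβ μ≤β = antisym (greatest β Pβ) μ≤β

  maximal⇒≡greatest : ∀ {P μ ν} → IsGreatest P μ → P ν → IsMaximal P ν → ν ≡ μ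
  maximal⇒≡greatest (Pμ , greatest) Pν maximal = sym (maximal _ Pμ (greatest _ Pν))

⊴-trans : ∀ {xs ys zs} → xs ⊴ ys → ys ⊴ zs → xs ⊴ zs
⊴-trans = Pointwise.transitive ≤-trans

⊴-antisym : ∀ {xs ys} → xs ⊴ ys → ys ⊴ xs → xs ≡ ys
⊴-antisym xs⊴ys ys⊴xs = Pointwise-≡⇒≡ (Pointwise.antisymmetric ≤-antisym xs⊴ys ys⊴xs)

open Extremal _⊴_ ⊴-antisym

infixr 30 _∨_

_∨_ : List ℕ → List ℕ → List ℕ
_∨_ = zipWith _⊔_

∨-upperˡ : ∀ {xs ys} → length xs ≡ length ys → xs ⊴ xs ∨ ys
∨-upperˡ {[]}     {[]}     _  = []
∨-upperˡ {x ∷ xs} {y ∷ ys} eq = m≤m⊔n x y ∷ ∨-upperˡ (suc-injective eq)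

∨-upperʳ : ∀ {xs ys} → length xs ≡ length ys → ys ⊴ xs ∨ ys
∨-upperʳ {xs} {ys} eq = subst (ys ⊴_) (zipWith-comm _⊔_ ⊔-comm ys xs) (∨-upperˡ (sym eq))

∨-lub : ∀ {xs ys zs} → xs ⊴ zs → ys ⊴ zs → xs ∨ ys ⊴ zs
∨-lub []            []            = []
∨-lub (x≤z ∷ xs⊴zs) (y≤z ∷ ys⊴zs) = ⊔-lub x≤z y≤z ∷ ∨-lub xs⊴zs ys⊴zs

∈-∨⁻ : ∀ {x} xs ys → x ∈ xs ∨ ys → x ∈ xs ⊎ x ∈ ys
∈-∨⁻ (a ∷ _) (b ∷ _) (here refl) with ⊔-sel a b
... | inj₁ a⊔b≡a = inj₁ (here a⊔b≡a)
... | inj₂ a⊔b≡b = inj₂ (here a⊔b≡b)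
∈-∨⁻ (_ ∷ xs) (_ ∷ ys) (there x∈xs∨ys) with ∈-∨⁻ xs ys x∈xs∨ys
... | inj₁ x∈xs = inj₁ (there x∈xs)
... | inj₂ x∈ys = inj₂ (there x∈ys)

All-∨⁺ : ∀ {P : Pred ℕ 0ℓ} {xs ys} → All P xs → All P ys → All P (xs ∨ ys)
All-∨⁺ {xs = xs} {ys} Pxs Pys = All.tabulate λ x∈xs∨ys →
  [ All.lookup Pxs , All.lookup Pys ] (∈-∨⁻ xs ys x∈xs∨ys)

∨-linked : ∀ {xs ys} → Linked _<_ xs → Linked _<_ ys → Linked _<_ (xs ∨ ys)
∨-linked []           _            = []
∨-linked [-]          []           = []
∨-linked (_ ∷ _)      []           = []
∨-linked [-]          [-]          = [-]
∨-linked [-]          (_ ∷ _)      = [-]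
∨-linked (_ ∷ _)      [-]          = [-]
∨-linked (x<x′ ∷ xs↑) (y<y′ ∷ ys↑) = ⊔-mono-< x<x′ y<y′ ∷ ∨-linked xs↑ ys↑

private
  head<tail : ∀ {x xs} → Linked _<_ (x ∷ xs) → All (x <_) xs
  head<tail xs↑ = AllPairs.head (Linked⇒AllPairs <-trans xs↑)

∈-∨⁺ : ∀ {x xs ys} → Linked _<_ xs → Linked _<_ ys → x ∈ xs → x ∈ ys → x ∈ xs ∨ ys
∈-∨⁺ {x} _   _   (here refl) (here refl) = here (sym (⊔-idem x))
∈-∨⁺     _   ys↑ (here refl) (there x∈ys) =
  here (sym (m≥n⇒m⊔n≡m (<⇒≤ (All.lookup (head<tail ys↑) x∈ys))))
∈-∨⁺     xs↑ _   (there x∈xs) (here refl) =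
  here (sym (m≤n⇒m⊔n≡n (<⇒≤ (All.lookup (head<tail xs↑) x∈xs))))
∈-∨⁺     xs↑ ys↑ (there x∈xs) (there x∈ys) =
  there (∈-∨⁺ (Linked.tail xs↑) (Linked.tail ys↑) x∈xs x∈ys)

boundedBy : List ℕ → List (List ℕ)
boundedBy []       = [] ∷ []
boundedBy (v ∷ vs) = cartesianProductWith _∷_ (upTo (suc v)) (boundedBy vs)

∈-boundedBy : ∀ {β W} → β ⊴ W → β ∈ boundedBy W
∈-boundedBy []          = here refl
∈-boundedBy (b≤v ∷ β⊴W) = ∈-cartesianProductWith⁺ _∷_ (∈-upTo⁺ (s≤s b≤v)) (∈-boundedBy β⊴W)

module _ {P : Pred (List ℕ) 0ℓ} (P-∨ : ∀ {β γ} → P β → P γ → P (β ∨ γ))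
         {W : List ℕ} (P⇒⊴W : ∀ {β} → P β → β ⊴ W) where

  private
    sameLength : ∀ {β γ} → P β → P γ → length β ≡ length γ
    sameLength Pβ Pγ = trans (Pointwise-length (P⇒⊴W Pβ)) (sym (Pointwise-length (P⇒⊴W Pγ)))

  foldr-∨-closed : ∀ {μ} L → P μ → All P L → P (foldr _∨_ μ L)
  foldr-∨-closed []      Pμ All.[]         = Pμ
  foldr-∨-closed (_ ∷ L) Pμ (Pβ All.∷ PL) = P-∨ Pβ (foldr-∨-closed L Pμ PL)

  foldr-∨-upper : ∀ {μ} L → P μ → All P L → All (_⊴ foldr _∨_ μ L) L
  foldr-∨-upper []      _  All.[]         = All.[]
  foldr-∨-upper (_ ∷ L) Pμ (Pβ All.∷ PL) =
    ∨-upperˡ |β|≡|rest| All.∷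
    All.map (λ γ⊴rest → ⊴-trans γ⊴rest (∨-upperʳ |β|≡|rest|)) (foldr-∨-upper L Pμ PL)
    where |β|≡|rest| = sameLength Pβ (foldr-∨-closed L Pμ PL)

  greatest : Decidable P → ∃ P → ∃ (IsGreatest P)
  greatest P? (μ , Pμ) =
    foldr _∨_ μ L , foldr-∨-closed L Pμ PL , λ β Pβ →
      All.lookup (foldr-∨-upper L Pμ PL) (∈-filter⁺ P? (∈-boundedBy (P⇒⊴W Pβ)) Pβ)
    where
    L = filter P? (boundedBy W)
    PL = all-filter P? (boundedBy W)

IncSeq-∨ : ∀ {β γ} → IncSeq β → IncSeq γ → IncSeq (β ∨ γ)
IncSeq-∨ (β↑ , β⁺) (γ↑ , γ⁺) = ∨-linked β↑ γ↑ , All-∨⁺ β⁺ γ⁺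

A-∨ : ∀ k w {β γ} → A k w β → A k w γ → A k w (β ∨ γ)
A-∨ _ _ (βinc , refl , β⊴w) (γinc , _ , γ⊴w) =
  IncSeq-∨ βinc γinc , trans (Pointwise-length β∨γ⊴w) (sym (Pointwise-length β⊴w)) , β∨γ⊴w
  where β∨γ⊴w = ∨-lub β⊴w γ⊴w

Aη-∨ : ∀ k η w {β γ} → Aη k η w β → Aη k η w γ → Aη k η w (β ∨ γ)
Aη-∨ k _ w {β} {γ} (Aβ , η₂⊆β , β⊆η) (Aγ , η₂⊆γ , γ⊆η) =
  A-∨ k w Aβ Aγ ,
  (λ x x∈η₂ → ∈-∨⁺ (proj₁ (proj₁ Aβ)) (proj₁ (proj₁ Aγ)) (η₂⊆β x x∈η₂) (η₂⊆γ x x∈η₂)) ,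
  (λ x x∈β∨γ → [ β⊆η x , γ⊆η x ] (∈-∨⁻ β γ x∈β∨γ))

Aη⇒⊴ : ∀ k η w {β} → Aη k η w β → β ⊴ (w ^[ k ])
Aη⇒⊴ _ _ _ ((_ , _ , β⊴w) , _) = β⊴w

IncSeq? : Decidable IncSeq
IncSeq? β = linked? _<?_ β ×-dec all? (1 ≤?_) β

A? : ∀ k w → Decidable (A k w)
A? k w β = IncSeq? β ×-dec length β ≟ k ×-dec Pointwise.decidable _≤?_ β (w ^[ k ])

Aη? : ∀ k η w → Decidable (Aη k η w)
Aη? k η w β =
  A? k w β
  ×-dec map′ (λ η₂⊆β x → η₂⊆β {x}) (λ η₂⊆β {x} → η₂⊆β x) (η₂ ⊆? β)
  ×-dec map′ (λ β⊆η _ → All.lookup β⊆η) (λ β⊆η → All.tabulate (β⊆η _))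
             (all? (λ x → x ∈? η₁ ⊎-dec x ∈? η₂) β)
  where open MultiSet η

proposition2p6 : (w : S∞) (k : ℕ) → 1 ≤ k → (η : MultiSet) →
    (∃ λ β → Aη k η w β) →
    Σ (List ℕ) λ μ →
      Aη k η w μ
      × (∀ β → Aη k η w β → μ ⊴ β → β ≡ μ)
      × (∀ ν → Aη k η w ν → (∀ β → Aη k η w β → ν ⊴ β → β ≡ ν) → ν ≡ μ)
      × (∀ β → Aη k η w β → β ⊴ μ)
proposition2p6 w k _ η nonempty
  with μ , μ-greatest@(Aημ , below-μ) ←
         greatest (Aη-∨ k η w) (Aη⇒⊴ k η w) (Aη? k η w) nonempty =
  μ , Aημ , greatest⇒maximal μ-greatest , (λ ν → maximal⇒≡greatest μ-greatest) , below-μ
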